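{- Let $\mathbb{F}$ be a field of positive characteristic $p$ and $S$ an association scheme on a finite set $X$. If $O^\vartheta(S)\subseteq O_\vartheta(S)$ and $\langle S_{p'}\rangle=S$, then $S$ is $p$-transitive.
   Context: $S=\{R_0,\dots,R_d\}$ is an association scheme on $X$ with diagonal $R_0$, transposes $R_{i^*}$, intersection numbers $p_{ij}^k$, valencies $k_i=p_{ii^*}^0$. $S_{p'}=\{R_i\in S:p\nmid k_i\}$. For nonempty $U,V\subseteq S$, $UV=\{R_k:\exists R_u\in U,R_v\in V,\ p_{uv}^k>0\}$. A nonempty $T\subseteq S$ is closed if $T^*T\subseteq T$ ($T^*=\{R_{i^*}:R_i\in T\}$), strongly normal if also $R_{i^*}TR_i\subseteq T$ for all $i$. $\langle H\rangle$ is the intersection of all closed subsets containing $H$. $O_\vartheta(S)=\{R_i:k_i=1\}$; $O^\vartheta(S)$ is the intersection of all strongly normal closed subsets. $\overline{A_i}$ is the image in $M_X(\mathbb{F})$ of the adjacency matrix of $R_i$, $\mathbb{F}S=\mathrm{span}_{\mathbb{F}}\{\overline{A_i}\}$, $\overline{k_i}$ the image of $k_i$ in $\mathbb{F}$. A trivial submodule of the regular $\mathbb{F}S$-module is $\langle v\rangle_{\mathbb{F}}$ with $0\ne v\in\mathbb{F}S$ and $\overline{A_i}v=\overline{k_i}v$ for all $i$; $S$ is $p$-transitive if there is exactly one such submodule. -}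

module Defs where

open import Level using (Level; _⊔_)
open import Data.Nat as ℕ using (ℕ; zero; suc; _<_)
open import Data.Nat.Divisibility using (_∣_)
open import Data.Nat.Primality using (Prime)
open import Data.Fin using (Fin; zero; suc)
open import Data.Fin.Subset using (Subset; _∈_; Nonempty)
open import Data.Bool using (Bool; true; false; if_then_else_; _∧_)
open import Data.Product using (Σ; ∃; ∃-syntax; _×_; _,_)
open import Relation.Nullary using (¬_; does)
open import Relation.Binary.PropositionalEquality using (_≡_)
open import Algebra.Bundles using (CommutativeRing)
import Data.Fin as F

record Field (c ℓ : Level) : Set (Level.suc (c ⊔ ℓ)) where
  field
    commutativeRing : CommutativeRing c ℓ
  open CommutativeRing commutativeRing public
  field
    1≉0     : ¬ (1# ≈ 0#)
    inverse : ∀ x → ¬ (x ≈ 0#) → ∃[ y ] (x * y ≈ 1#)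

module FieldOps {c ℓ} (𝔽 : Field c ℓ) where
  open Field 𝔽 using (Carrier; 0#; 1#; _+_)

  ι : ℕ → Carrier
  ι zero    = 0#
  ι (suc m) = 1# + ι m

  ∑ : ∀ m → (Fin m → Carrier) → Carrier
  ∑ zero    f = 0#
  ∑ (suc m) f = f zero + ∑ m (λ i → f (suc i))

-- 𝔽 has characteristic p (p prime, p·1 = 0; in a field this forces
-- the characteristic to be exactly p).
HasCharacteristic : ∀ {c ℓ} → Field c ℓ → ℕ → Set ℓ
HasCharacteristic 𝔽 p = Prime p × (ι p ≈ 0#)
  where open Field 𝔽 using (_≈_; 0#) ; open FieldOps 𝔽

count : ∀ m → (Fin m → Bool) → ℕ
count zero    P = 0
count (suc m) P = (if P zero then 1 else 0) ℕ.+ count m (λ i → P (suc i))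

-- Association schemes on X = Fin n with relations R_0,…,R_d indexed by
-- Fin (suc d).  rel x y = i means (x,y) ∈ R_i (so the R_i partition X×X).

record AssociationScheme : Set where
  field
    n d  : ℕ
    rel  : Fin n → Fin n → Fin (suc d)
    diag₁ : ∀ x → rel x x ≡ zero
    diag₂ : ∀ x y → rel x y ≡ zero → x ≡ y
    nonempty : ∀ i → ∃[ x ] ∃[ y ] (rel x y ≡ i)
    _* : Fin (suc d) → Fin (suc d)
    transpose : ∀ x y → rel y x ≡ (rel x y) *
    pn : Fin (suc d) → Fin (suc d) → Fin (suc d) → ℕ
    intersection : ∀ i j k x y → rel x y ≡ k →
      count n (λ z → does (rel x z F.≟ i) ∧ does (rel z y F.≟ j)) ≡ pn i j k

  Idx : Set
  Idx = Fin (suc d)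

  val : Idx → ℕ
  val i = pn i (i *) zero

  _∈Prod[_,_] : Idx → (Idx → Set) → (Idx → Set) → Set
  k ∈Prod[ U , V ] = ∃[ u ] ∃[ v ] (U u × V v × 0 < pn u v k)

  Closed : Subset (suc d) → Set
  Closed T = Nonempty T ×
    (∀ k → k ∈Prod[ (λ u → (u *) ∈ T) , (λ v → v ∈ T) ] → k ∈ T)

  StronglyNormalClosed : Subset (suc d) → Set
  StronglyNormalClosed T = Closed T ×
    (∀ i k → k ∈Prod[ (λ m → m ∈Prod[ (λ u → u ≡ i *) , (λ t → t ∈ T) ]) , (λ v → v ≡ i) ]
           → k ∈ T)

  _∈⟨_⟩ : Idx → (Idx → Set) → Set
  i ∈⟨ H ⟩ = ∀ T → Closed T → (∀ j → H j → j ∈ T) → i ∈ T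

  InOUpper : Idx → Set
  InOUpper i = ∀ T → StronglyNormalClosed T → i ∈ T

  InOLower : Idx → Set
  InOLower i = val i ≡ 1

  InSp' : ℕ → Idx → Set
  InSp' p i = ¬ (p ∣ val i)

module Adjacency {c ℓ} (𝔽 : Field c ℓ) (S : AssociationScheme) where
  open Field 𝔽 using (Carrier; _≈_; 0#; 1#; _*_)
  open FieldOps 𝔽
  open AssociationScheme S

  Mat : Set c
  Mat = Fin n → Fin n → Carrier

  Ā : Idx → Mat
  Ā i x y = if does (rel x y F.≟ i) then 1# else 0#

  _·_ : Mat → Mat → Mat
  (A · B) x y = ∑ n (λ z → A x z * B z y)

  In𝔽S : Mat → Set (c ⊔ ℓ)
  In𝔽S v = Σ (Idx → Carrier) λ coeff → (∀ x y → v x y ≈ ∑ (suc d) (λ j → coeff j * Ā j x y))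

  NonzeroMat : Mat → Set ℓ
  NonzeroMat v = ∃[ x ] ∃[ y ] (¬ (v x y ≈ 0#))

  -- v spans a trivial submodule: 0 ≠ v ∈ 𝔽S and Ā_i v = k̄_i v for all i
  TrivialGen : Mat → Set (c ⊔ ℓ)
  TrivialGen v = In𝔽S v × NonzeroMat v ×
    (∀ i x y → (Ā i · v) x y ≈ ι (val i) * v x y)

  InSpan : Mat → Mat → Set (c ⊔ ℓ)
  InSpan v u = Σ Carrier λ a → (∀ x y → u x y ≈ a * v x y)

  SameSpan : Mat → Mat → Set (c ⊔ ℓ)
  SameSpan v w = ∀ u → (InSpan v u → InSpan w u) × (InSpan w u → InSpan v u)

  -- exactly one trivial submodule of the regular 𝔽S-module
  PTransitive : Set (c ⊔ ℓ)
  PTransitive = Σ Mat λ v → (TrivialGen v × (∀ w → TrivialGen w → SameSpan v w))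

{-# OPTIONS --safe #-}
-- The all-ones matrix J spans a trivial submodule; the point is that every trivial
-- generator w is a multiple of J.  Since w ∈ 𝔽S, w(x,y) depends only on the relation
-- of (x,y), and Ā_i w = k̄_i w says that k̄_i w(x,y) is the sum of w(z,y) over the k_i
-- neighbours z of x in R_i.  Call R_k row-invariant if w(z,-) = w(x,-) whenever
-- (x,z) ∈ R_k.  A thin relation is row-invariant, and so is R_i when p ∤ k_i: two
-- R_i-neighbours of x are related by an element of R_{i*}R_i ⊆ O^ϑ(S) ⊆ O_ϑ(S), so
-- all summands agree and k̄_i ≠ 0 can be cancelled.  Row-invariant relations are
-- closed under complex products, hence by ⟨S_{p'}⟩ = S every relation is
-- row-invariant, and w(x,y) = w(y,y) is the coefficient of R_0 in w.
module Submission where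

open import Defs
open import Data.Nat using (ℕ)
open import Level using (Level)

import Data.Nat as N
open import Data.Nat using (zero; suc; _<_; _≤_; z≤n; s≤s; _<?_)
open import Data.Nat.Properties using (suc-injective; <-irrefl; ≤-<-trans; <⇒≱)
open import Data.Nat.Divisibility using (_∣_; _∣?_; ∣1⇒≡1)
open import Data.Nat.Primality using (Prime; prime⇒irreducible; ¬prime[1])
open import Data.Nat.Coprimality using (Coprime; coprime-Bézout)
open import Data.Nat.GCD using (module Bézout)
open import Data.Nat.GeneralisedArithmetic using (fold)
open import Data.Fin using (Fin; zero; suc; _≟_)
open import Data.Fin.Properties using (any?)
open import Data.Fin.Subset using (Subset; _∈_; _⊆_; _∪_; ∣_∣)
open import Data.Fin.Subset.Properties
  using (_∈?_; ∣p∣≤n; p⊂q⇒∣p∣<∣q∣; p⊆p∪q; q⊆p∪q; x∈p∪q⁻)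
open import Data.Vec using (tabulate)
open import Data.Vec.Properties using (lookup⇒[]=; []=⇒lookup; lookup∘tabulate)
open import Data.Bool using (Bool; if_then_else_)
open import Data.Product using (∃; ∃-syntax; _×_; _,_; proj₁; proj₂)
open import Data.Sum using (_⊎_; inj₁; inj₂; [_,_]; map₂)
open import Function using (_∘_; id; mk⇔)
open import Relation.Unary using (Pred; Decidable)
open import Relation.Nullary using (¬_; does; Dec; yes; no; contradiction; ¬?; _×-dec_)
open import Relation.Nullary.Decidable using (dec-true; does-⇔; decidable-stable)
open import Relation.Binary.PropositionalEquality as ≡ using (_≡_; refl)

private
  variable
    a : Level
    m : ℕ

count-cong : {P Q : Fin m → Bool} → (∀ i → P i ≡ Q i) → count m P ≡ count m Q
count-cong {zero}  P≡Q = refl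
count-cong {suc m} P≡Q =
  ≡.cong₂ N._+_ (≡.cong (λ b → if b then 1 else 0) (P≡Q zero)) (count-cong (P≡Q ∘ suc))

count>0⇒∃ : ∀ {m} {P : Pred (Fin m) a} (P? : Decidable P) → 0 < count m (does ∘ P?) → ∃ P
count>0⇒∃ {m = suc m} P? pos with P? zero
... | yes P0 = zero , P0
... | no _ with count>0⇒∃ (P? ∘ suc) pos
...   | i , Pi = suc i , Pi

∃⇒count>0 : ∀ {m} {P : Pred (Fin m) a} (P? : Decidable P) {i} → P i → 0 < count m (does ∘ P?)
∃⇒count>0 {m = suc m} P? {i} Pi with P? zero | i
... | yes _  | _     = s≤s z≤n
... | no ¬P0 | zero  = contradiction Pi ¬P0
... | no _   | suc j = ∃⇒count>0 (P? ∘ suc) Pi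

∄⇒count≡0 : ∀ {m} {P : Pred (Fin m) a} (P? : Decidable P) → (∀ i → ¬ P i) → count m (does ∘ P?) ≡ 0
∄⇒count≡0 {m = zero}  P? ∄P = refl
∄⇒count≡0 {m = suc m} P? ∄P with P? zero
... | yes P0 = contradiction P0 (∄P zero)
... | no _   = ∄⇒count≡0 (P? ∘ suc) (∄P ∘ suc)

count≡0⇒¬ : ∀ {m} {P : Pred (Fin m) a} (P? : Decidable P) {i} → count m (does ∘ P?) ≡ 0 → ¬ P i
count≡0⇒¬ P? c≡0 Pi = <-irrefl refl (≡.subst (0 <_) c≡0 (∃⇒count>0 P? Pi))

count≡1⇒unique : ∀ {m} {P : Pred (Fin m) a} (P? : Decidable P) {i j} →
                 count m (does ∘ P?) ≡ 1 → P i → P j → i ≡ j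
count≡1⇒unique {m = suc m} P? {i} {j} c≡1 Pi Pj with P? zero | i | j
... | yes _  | zero  | zero  = refl
... | yes _  | zero  | suc _ = contradiction Pj (count≡0⇒¬ (P? ∘ suc) (suc-injective c≡1))
... | yes _  | suc _ | _     = contradiction Pi (count≡0⇒¬ (P? ∘ suc) (suc-injective c≡1))
... | no ¬P0 | zero  | _     = contradiction Pi ¬P0
... | no ¬P0 | suc _ | zero  = contradiction Pj ¬P0
... | no _   | suc _ | suc _ = ≡.cong suc (count≡1⇒unique (P? ∘ suc) c≡1 Pi Pj)

count-≟ : ∀ {m} (i : Fin m) → count m (does ∘ (i ≟_)) ≡ 1
count-≟ {m = suc m} zero    = ≡.cong suc (∄⇒count≡0 {m = m} (λ i → zero ≟ suc i) (λ _ ()))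
count-≟ {m = suc m} (suc i) = count-≟ i

subset : {P : Pred (Fin m) a} → Decidable P → Subset m
subset P? = tabulate (does ∘ P?)

∈-subset⁺ : {P : Pred (Fin m) a} (P? : Decidable P) {i : Fin m} → P i → i ∈ subset P?
∈-subset⁺ P? {i} Pi = lookup⇒[]= i _ (≡.trans (lookup∘tabulate (does ∘ P?) i) (dec-true (P? i) Pi))

∈-subset⁻ : {P : Pred (Fin m) a} (P? : Decidable P) {i : Fin m} → i ∈ subset P? → P i
∈-subset⁻ P? {i} i∈ with P? i | ≡.trans (≡.sym (lookup∘tabulate (does ∘ P?) i)) ([]=⇒lookup i∈)
... | yes Pi | _  = Pi
... | no _   | ()

Inflationary : (Subset m → Subset m) → Set
Inflationary f = ∀ p → p ⊆ f p

⊆-fold : {f : Subset m → Subset m} → Inflationary f → ∀ p j → p ⊆ fold p f j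
⊆-fold infl p zero    i∈p = i∈p
⊆-fold infl p (suc j) i∈p = infl _ (⊆-fold infl p j i∈p)

fold-reaches-postfixedPoint : {f : Subset m → Subset m} → Inflationary f →
                              ∀ p → ∃[ s ] f (fold p f s) ⊆ fold p f s
fold-reaches-postfixedPoint {m = m} {f} infl p =
  [ id , (λ m<∣X∣ → contradiction (∣p∣≤n (fold p f (suc m))) (<⇒≱ m<∣X∣)) ] (reachedOrGrown (suc m))
  where
  reachedOrGrown : ∀ j → (∃[ s ] f (fold p f s) ⊆ fold p f s) ⊎ j ≤ ∣ fold p f j ∣
  reachedOrGrown zero = inj₂ z≤n
  reachedOrGrown (suc j) with reachedOrGrown j
  ... | inj₁ reached = inj₁ reached
  ... | inj₂ j≤∣X∣ with any? (λ i → (i ∈? f (fold p f j)) ×-dec ¬? (i ∈? fold p f j))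
  ...   | yes (i , i∈fX , i∉X) = inj₂ (≤-<-trans j≤∣X∣ (p⊂q⇒∣p∣<∣q∣ (infl _ , i , i∈fX , i∉X)))
  ...   | no ∄new = inj₁ (j , λ i∈fX → decidable-stable (_ ∈? _) (λ i∉X → ∄new (_ , i∈fX , i∉X)))

module SchemeProperties (S : AssociationScheme) where
  open AssociationScheme S

  rel-transpose : ∀ {x y i} → rel x y ≡ i → rel y x ≡ i *
  rel-transpose {x} {y} refl = transpose x y

  *-involutive : ∀ i → i * * ≡ i
  *-involutive i with x , y , xRy ← nonempty i = ≡.trans (≡.sym (rel-transpose (rel-transpose xRy))) xRy

  PathVia : Idx → Idx → Fin n → Fin n → Fin n → Set
  PathVia u v x y z = rel x z ≡ u × rel z y ≡ v

  pathVia? : ∀ u v x y → Decidable (PathVia u v x y)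
  pathVia? u v x y z = (rel x z ≟ u) ×-dec (rel z y ≟ v)

  pn-pos⇒path : ∀ {u v k x y} → 0 < pn u v k → rel x y ≡ k → ∃ (PathVia u v x y)
  pn-pos⇒path {u} {v} {k} {x} {y} pos xRy =
    count>0⇒∃ (pathVia? u v x y) (≡.subst (0 <_) (≡.sym (intersection u v k x y xRy)) pos)

  path⇒pn-pos : ∀ {u v k x y z} → rel x z ≡ u → rel z y ≡ v → rel x y ≡ k → 0 < pn u v k
  path⇒pn-pos {u} {v} {k} {x} {y} xRz zRy xRy =
    ≡.subst (0 <_) (intersection u v k x y xRy) (∃⇒count>0 (pathVia? u v x y) (xRz , zRy))

  count-neighbours : ∀ x i → count n (does ∘ λ z → rel x z ≟ i) ≡ val i
  count-neighbours x i = ≡.trans (count-cong same) (intersection i (i *) zero x x (diag₁ x))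
    where
    same : ∀ z → does (rel x z ≟ i) ≡ does (pathVia? i (i *) x x z)
    same z = does-⇔ (mk⇔ (λ xRz → xRz , rel-transpose xRz) proj₁) (rel x z ≟ i) (pathVia? i (i *) x x z)

  val-zero : val zero ≡ 1
  val-zero = ≡.trans (≡.sym (count-neighbours x zero)) (≡.trans (count-cong same) (count-≟ x))
    where
    x : Fin n
    x = proj₁ (nonempty zero)
    same : ∀ z → does (rel x z ≟ zero) ≡ does (x ≟ z)
    same z = does-⇔ (mk⇔ (diag₂ x z) λ { refl → diag₁ x }) (rel x z ≟ zero) (x ≟ z)

  zero∈closed : ∀ {T} → Closed T → zero ∈ T
  zero∈closed {T} ((t , t∈T) , closed) with x , y , xRy ← nonempty t =
    closed zero (t * , t , ≡.subst (_∈ T) (≡.sym (*-involutive t)) t∈T , t∈T ,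
                 path⇒pn-pos (rel-transpose xRy) xRy (diag₁ y))

  pn-pos⇒InOUpper : ∀ {i l} → 0 < pn (i *) i l → InOUpper l
  pn-pos⇒InOUpper {i} {l} pos T (closedT , normal) =
    normal i l (i * , i , (i * , zero , refl , zero∈closed closedT , i*∈i*0) , refl , pos)
    where
    i*∈i*0 : 0 < pn (i *) zero (i *)
    i*∈i*0 with x , y , xRy ← nonempty (i *) = path⇒pn-pos xRy (diag₁ y) xRy

  products? : ∀ C → Decidable (_∈Prod[ (λ u → u * ∈ C) , (_∈ C) ])
  products? C k = any? λ u → any? λ v → (u * ∈? C) ×-dec (v ∈? C) ×-dec (0 <? pn u v k)

  adjoinProducts : Subset (suc d) → Subset (suc d)
  adjoinProducts C = C ∪ subset (products? C)

  adjoin-inflationary : Inflationary adjoinProducts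
  adjoin-inflationary C = p⊆p∪q (subset (products? C))

  products⊆adjoinProducts : ∀ C {k} → k ∈Prod[ (λ u → u * ∈ C) , (_∈ C) ] → k ∈ adjoinProducts C
  products⊆adjoinProducts C = q⊆p∪q C (subset (products? C)) ∘ ∈-subset⁺ (products? C)

  ∈adjoinProducts⁻ : ∀ C {k} → k ∈ adjoinProducts C → k ∈ C ⊎ k ∈Prod[ (λ u → u * ∈ C) , (_∈ C) ]
  ∈adjoinProducts⁻ C k∈ = map₂ (∈-subset⁻ (products? C)) (x∈p∪q⁻ C (subset (products? C)) k∈)

  ProductClosed : ∀ {a} → Pred Idx a → Set a
  ProductClosed P = ∀ {u v k} → P (u *) → P v → 0 < pn u v k → P k

  -- ⟨H⟩ is reached from H by repeatedly adjoining the products T* T; H must be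
  -- decidable for the stages to be Subsets, whose finiteness stops the process.
  module _ {H : Idx → Set} (H? : Decidable H) where

    stage : ℕ → Subset (suc d)
    stage = fold (subset H?) adjoinProducts

    H⊆stage : ∀ j → subset H? ⊆ stage j
    H⊆stage = ⊆-fold {f = adjoinProducts} adjoin-inflationary (subset H?)

    closed-stage : ∀ j → ∃ H → adjoinProducts (stage j) ⊆ stage j → Closed (stage j)
    closed-stage j (h , Hh) stable =
      (h , H⊆stage j (∈-subset⁺ H? Hh)) ,
      λ k k∈T*T → stable (products⊆adjoinProducts (stage j) k∈T*T)

    stage⊆ : ∀ {a} {P : Pred Idx a} → (∀ i → H i → P i) → ProductClosed P → ∀ j {k} → k ∈ stage j → P k
    stage⊆ H⊆P closedP zero    k∈ = H⊆P _ (∈-subset⁻ H? k∈)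
    stage⊆ H⊆P closedP (suc j) k∈ =
      [ stage⊆ H⊆P closedP j
      , (λ (_ , _ , u*∈ , v∈ , pos) → closedP (stage⊆ H⊆P closedP j u*∈) (stage⊆ H⊆P closedP j v∈) pos)
      ] (∈adjoinProducts⁻ (stage j) k∈)

    closure-induction : ∃ H → ∀ {a} {P : Pred Idx a} → (∀ i → H i → P i) → ProductClosed P →
                        ∀ i → i ∈⟨ H ⟩ → P i
    closure-induction ∃H H⊆P closedP i i∈⟨H⟩ =
      stage⊆ H⊆P closedP s (i∈⟨H⟩ (stage s) (closed-stage s ∃H stable) (λ _ → H⊆stage s ∘ ∈-subset⁺ H?))
      where
      postfixed : ∃[ s ] adjoinProducts (stage s) ⊆ stage s
      postfixed = fold-reaches-postfixedPoint {f = adjoinProducts} adjoin-inflationary (subset H?)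
      s : ℕ
      s = proj₁ postfixed
      stable : adjoinProducts (stage s) ⊆ stage s
      stable = proj₂ postfixed

prime∤⇒coprime : ∀ {p n} → Prime p → ¬ p ∣ n → Coprime p n
prime∤⇒coprime prime-p p∤n (d∣p , d∣n) with prime⇒irreducible prime-p d∣p
... | inj₁ d≡1  = d≡1
... | inj₂ refl = contradiction d∣n p∤n

module FieldProperties {c ℓ} (𝔽 : Field c ℓ) where
  open Field 𝔽 hiding (zero) renaming (refl to ≈-refl)
  open FieldOps 𝔽
  open import Algebra.Properties.Semiring.Mult semiring using (×1-homo-*) renaming (_×_ to _×ₙ_)
  open import Relation.Binary.Reasoning.Setoid setoid

  ι≡×1# : ∀ m → ι m ≡ m ×ₙ 1#
  ι≡×1# zero    = refl
  ι≡×1# (suc m) = ≡.cong (1# +_) (ι≡×1# m)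

  ι-homo-* : ∀ m n → ι (m N.* n) ≈ ι m * ι n
  ι-homo-* m n = begin
    ι (m N.* n)               ≡⟨ ι≡×1# (m N.* n) ⟩
    (m N.* n) ×ₙ 1#           ≈⟨ ×1-homo-* m n ⟩
    (m ×ₙ 1#) * (n ×ₙ 1#)     ≡⟨ ≡.sym (≡.cong₂ _*_ (ι≡×1# m) (ι≡×1# n)) ⟩
    ι m * ι n                 ∎

  ι-1 : ι 1 ≈ 1#
  ι-1 = +-identityʳ 1#

  ι-multiple : ∀ {m} → ι m ≈ 0# → ∀ k → ι (k N.* m) ≈ 0#
  ι-multiple {m} ιm≈0 k = trans (ι-homo-* k m) (trans (*-congˡ ιm≈0) (zeroʳ (ι k)))

  -- By Bézout, 1 + y m = x p or 1 + x p = y m; both sides vanish in 𝔽.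
  ι-nonzero : ∀ {p} → HasCharacteristic 𝔽 p → ∀ {m} → ¬ p ∣ m → ¬ ι m ≈ 0#
  ι-nonzero {p} (prime-p , ιp≈0) {m} p∤m ιm≈0 with coprime-Bézout (prime∤⇒coprime prime-p p∤m)
  ... | Bézout.+- x y 1+ym≡xp = 1≉0 (begin
    1#                 ≈⟨ sym (+-identityʳ 1#) ⟩
    1# + 0#            ≈⟨ +-congˡ (sym (ι-multiple ιm≈0 y)) ⟩
    ι (1 N.+ y N.* m)  ≡⟨ ≡.cong ι 1+ym≡xp ⟩
    ι (x N.* p)        ≈⟨ ι-multiple ιp≈0 x ⟩
    0#                 ∎)
  ... | Bézout.-+ x y 1+xp≡ym = 1≉0 (begin
    1#                 ≈⟨ sym (+-identityʳ 1#) ⟩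
    1# + 0#            ≈⟨ +-congˡ (sym (ι-multiple ιp≈0 x)) ⟩
    ι (1 N.+ x N.* p)  ≡⟨ ≡.cong ι 1+xp≡ym ⟩
    ι (y N.* m)        ≈⟨ ι-multiple ιm≈0 y ⟩
    0#                 ∎)

  *-cancelˡ : ∀ {k x y} → ¬ k ≈ 0# → k * x ≈ k * y → x ≈ y
  *-cancelˡ {k} {x} {y} k≉0 kx≈ky with k⁻¹ , k*k⁻¹≈1 ← inverse k k≉0 = begin
    x              ≈⟨ sym (*-identityˡ x) ⟩
    1# * x         ≈⟨ *-congʳ (sym k⁻¹*k≈1) ⟩
    (k⁻¹ * k) * x  ≈⟨ *-assoc k⁻¹ k x ⟩
    k⁻¹ * (k * x)  ≈⟨ *-congˡ kx≈ky ⟩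
    k⁻¹ * (k * y)  ≈⟨ sym (*-assoc k⁻¹ k y) ⟩
    (k⁻¹ * k) * y  ≈⟨ *-congʳ k⁻¹*k≈1 ⟩
    1# * y         ≈⟨ *-identityˡ y ⟩
    y              ∎
    where
    k⁻¹*k≈1 : k⁻¹ * k ≈ 1#
    k⁻¹*k≈1 = trans (*-comm k⁻¹ k) k*k⁻¹≈1

  ∑-cong : ∀ {m} {f g : Fin m → Carrier} → (∀ i → f i ≈ g i) → ∑ m f ≈ ∑ m g
  ∑-cong {zero}  f≈g = ≈-refl
  ∑-cong {suc m} f≈g = +-cong (f≈g zero) (∑-cong (f≈g ∘ suc))

  indicator : ∀ {A : Set a} → Dec A → Carrier
  indicator A? = if does A? then 1# else 0#

  ∑-indicator : ∀ {m} {P : Pred (Fin m) a} (P? : Decidable P) (g : Fin m → Carrier) {x} →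
                (∀ i → P i → g i ≈ x) →
                ∑ m (λ i → indicator (P? i) * g i) ≈ ι (count m (does ∘ P?)) * x
  ∑-indicator {m = zero}  P? g {x} g≈x = sym (zeroˡ x)
  ∑-indicator {m = suc m} P? g {x} g≈x with P? zero
  ... | yes P0 = begin
    1# * g zero + ∑ m _       ≈⟨ +-cong (trans (*-identityˡ (g zero)) (g≈x zero P0)) rest ⟩
    x + ι k * x               ≈⟨ +-congʳ (sym (*-identityˡ x)) ⟩
    1# * x + ι k * x          ≈⟨ sym (distribʳ x 1# (ι k)) ⟩
    (1# + ι k) * x            ∎
    where
    k : ℕ
    k = count m (does ∘ P? ∘ suc)
    rest : ∑ m (λ i → indicator (P? (suc i)) * g (suc i)) ≈ ι k * x
    rest = ∑-indicator (P? ∘ suc) (g ∘ suc) (g≈x ∘ suc)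
  ... | no _ = trans (+-cong (zeroˡ (g zero)) (∑-indicator (P? ∘ suc) (g ∘ suc) (g≈x ∘ suc)))
                     (+-identityˡ _)

  ∑-delta : ∀ {m} (i : Fin m) (g : Fin m → Carrier) → ∑ m (λ j → g j * indicator (i ≟ j)) ≈ g i
  ∑-delta {m} i g = begin
    ∑ m (λ j → g j * indicator (i ≟ j))       ≈⟨ ∑-cong (λ j → *-comm (g j) _) ⟩
    ∑ m (λ j → indicator (i ≟ j) * g j)       ≈⟨ ∑-indicator (i ≟_) g (λ j i≡j → reflexive (≡.cong g (≡.sym i≡j))) ⟩
    ι (count m (does ∘ (i ≟_))) * g i         ≡⟨ ≡.cong (λ c → ι c * g i) (count-≟ i) ⟩
    ι 1 * g i                                 ≈⟨ trans (*-congʳ ι-1) (*-identityˡ (g i)) ⟩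
    g i                                       ∎

module TrivialSubmodules {c ℓ} (𝔽 : Field c ℓ) (S : AssociationScheme) where
  open Field 𝔽 hiding (zero) renaming (refl to ≈-refl)
  open FieldOps 𝔽
  open FieldProperties 𝔽
  open AssociationScheme S
  open SchemeProperties S
  open Adjacency 𝔽 S
  open import Relation.Binary.Reasoning.Setoid setoid

  TrivialAction : Mat → Set ℓ
  TrivialAction w = ∀ i x y → (Ā i · w) x y ≈ ι (val i) * w x y

  RowInvariant : Mat → Idx → Set ℓ
  RowInvariant w k = ∀ {x z} y → rel x z ≡ k → w z y ≈ w x y

  In𝔽S⇒entry : ∀ {v} → ((coeff , _) : In𝔽S v) → ∀ x y → v x y ≈ coeff (rel x y)
  In𝔽S⇒entry (coeff , v≈∑) x y = trans (v≈∑ x y) (∑-delta (rel x y) coeff)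

  row-sum : ∀ {w x y i a} → (∀ z → rel x z ≡ i → w z y ≈ a) → (Ā i · w) x y ≈ ι (val i) * a
  row-sum {w} {x} {y} {i} {a} w≈a =
    trans (∑-indicator (λ z → rel x z ≟ i) (λ z → w z y) w≈a)
          (reflexive (≡.cong (λ k → ι k * a) (count-neighbours x i)))

  rowInvariant-product : ∀ {w} → ProductClosed (RowInvariant w)
  rowInvariant-product {w} inv-u* inv-v pos {x} {z} y xRz
    with m , xRm , mRz ← pn-pos⇒path pos xRz = trans (inv-v y mRz) (sym (inv-u* y (rel-transpose xRm)))

  module _ {w} (trivial : TrivialAction w) where

    rowInvariant-by-averaging : ∀ {i} → ¬ ι (val i) ≈ 0# →
      (∀ {x z z′} y → rel x z ≡ i → rel x z′ ≡ i → w z y ≈ w z′ y) → RowInvariant w i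
    rowInvariant-by-averaging {i} k̄≉0 constant {x} {z} y xRz = *-cancelˡ k̄≉0 (begin
      ι (val i) * w z y  ≈⟨ sym (row-sum {w = w} {y = y} (λ z′ xRz′ → constant y xRz′ xRz)) ⟩
      (Ā i · w) x y      ≈⟨ trivial i x y ⟩
      ι (val i) * w x y  ∎)

    rowInvariant-thin : ∀ {l} → InOLower l → RowInvariant w l
    rowInvariant-thin {l} val≡1 = rowInvariant-by-averaging k̄≉0 λ {x} y xRz xRz′ →
      reflexive (≡.cong (λ t → w t y)
        (count≡1⇒unique (λ t → rel x t ≟ l) (≡.trans (count-neighbours x l) val≡1) xRz xRz′))
      where
      k̄≉0 : ¬ ι (val l) ≈ 0#
      k̄≉0 rewrite val≡1 = 1≉0 ∘ trans (sym ι-1)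

    module _ {p} (char : HasCharacteristic 𝔽 p) (upper⊆lower : ∀ i → InOUpper i → InOLower i) where

      rowInvariant-p′ : ∀ {i} → InSp' p i → RowInvariant w i
      rowInvariant-p′ p∤k = rowInvariant-by-averaging (ι-nonzero char p∤k) λ y xRz xRz′ →
        sym (rowInvariant-thin (upper⊆lower _ (pn-pos⇒InOUpper (path⇒pn-pos (rel-transpose xRz) xRz′ refl)))
                               y refl)

      rowInvariant-all : (∀ i → i ∈⟨ InSp' p ⟩) → ∀ k → RowInvariant w k
      rowInvariant-all generated k =
        closure-induction (λ i → ¬? (p ∣? val i)) (zero , p∤val-zero)
                          (λ _ → rowInvariant-p′) rowInvariant-product k (generated k)
        where
        p∤val-zero : ¬ p ∣ val zero
        p∤val-zero p∣k₀ with refl ← ∣1⇒≡1 (≡.subst (p ∣_) val-zero p∣k₀) = ¬prime[1] (proj₁ char)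

  J : Mat
  J _ _ = 1#

  J-trivialGen : TrivialGen J
  J-trivialGen = ((λ _ → 1#) , λ x y → sym (∑-delta (rel x y) (λ _ → 1#))) ,
                 (x₀ , x₀ , 1≉0) ,
                 λ i x y → row-sum {w = J} {y = y} (λ _ _ → ≈-refl)
    where
    x₀ : Fin n
    x₀ = proj₁ (nonempty zero)

  trivialGen-multiple-of-J :
    ∀ {p} → HasCharacteristic 𝔽 p → (∀ i → InOUpper i → InOLower i) → (∀ i → i ∈⟨ InSp' p ⟩) →
    ∀ {w} → TrivialGen w → ∃[ a ] (¬ a ≈ 0# × ∀ x y → w x y ≈ a * J x y)
  trivialGen-multiple-of-J char upper⊆lower generated {w} (w∈𝔽S@(coeff , _) , (x₀ , y₀ , w≉0) , trivial) =
    coeff zero , (λ a≈0 → w≉0 (trans (w≈coeff₀ x₀ y₀) a≈0)) ,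
    λ x y → trans (w≈coeff₀ x y) (sym (*-identityʳ _))
    where
    w≈coeff₀ : ∀ x y → w x y ≈ coeff zero
    w≈coeff₀ x y = begin
      w x y              ≈⟨ sym (rowInvariant-all trivial char upper⊆lower generated (rel x y) y refl) ⟩
      w y y              ≈⟨ In𝔽S⇒entry w∈𝔽S y y ⟩
      coeff (rel y y)    ≡⟨ ≡.cong coeff (diag₁ y) ⟩
      coeff zero         ∎

  sameSpan-scale : ∀ {v w a} → ¬ a ≈ 0# → (∀ x y → w x y ≈ a * v x y) → SameSpan v w
  sameSpan-scale {v} {w} {a} a≉0 w≈av u = v⇒w , w⇒v
    where
    a⁻¹ : Carrier
    a⁻¹ = proj₁ (inverse a a≉0)
    a⁻¹*a≈1 : a⁻¹ * a ≈ 1#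
    a⁻¹*a≈1 = trans (*-comm a⁻¹ a) (proj₂ (inverse a a≉0))
    v⇒w : InSpan v u → InSpan w u
    v⇒w (b , u≈bv) = b * a⁻¹ , λ x y → begin
      u x y                    ≈⟨ u≈bv x y ⟩
      b * v x y                ≈⟨ *-congˡ (sym (*-identityˡ (v x y))) ⟩
      b * (1# * v x y)         ≈⟨ *-congˡ (*-congʳ (sym a⁻¹*a≈1)) ⟩
      b * ((a⁻¹ * a) * v x y)  ≈⟨ *-congˡ (*-assoc a⁻¹ a (v x y)) ⟩
      b * (a⁻¹ * (a * v x y))  ≈⟨ sym (*-assoc b a⁻¹ _) ⟩
      (b * a⁻¹) * (a * v x y)  ≈⟨ *-congˡ (sym (w≈av x y)) ⟩
      (b * a⁻¹) * w x y        ∎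
    w⇒v : InSpan w u → InSpan v u
    w⇒v (b , u≈bw) = b * a , λ x y → begin
      u x y           ≈⟨ u≈bw x y ⟩
      b * w x y       ≈⟨ *-congˡ (w≈av x y) ⟩
      b * (a * v x y) ≈⟨ sym (*-assoc b a (v x y)) ⟩
      (b * a) * v x y ∎

corollary4p8 : ∀ {c ℓ : Level} (𝔽 : Field c ℓ) (p : ℕ) → HasCharacteristic 𝔽 p →
    (S : AssociationScheme) →
    (∀ i → AssociationScheme.InOUpper S i → AssociationScheme.InOLower S i) →
    (∀ i → AssociationScheme._∈⟨_⟩ S i (AssociationScheme.InSp' S p)) →
    Adjacency.PTransitive 𝔽 S
corollary4p8 𝔽 p char S upper⊆lower generated =
  J , J-trivialGen , λ w w-trivial →
    let a , a≉0 , w≈aJ = trivialGen-multiple-of-J char upper⊆lower generated w-trivial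
    in  sameSpan-scale a≉0 w≈aJ
  where open TrivialSubmodules 𝔽 S
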